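{- Every maximal clique-partition of $G$ is represented by a configuration in $\mathbb{T}^S(G)$, i.e., for every maximal clique-partition $\mathcal{P}$ of $G$ there is a configuration $\mathit{cfg}$ occurring in $\mathbb{T}^S(G)$ with $\mathit{repr}(\mathit{cfg})=\mathcal{P}$.
   Context: Let $G=(V,E)$ be a finite undirected graph. A clique is a nonempty set of pairwise adjacent vertices; it is maximal if not properly contained in another clique. A clique-partition of $G$ is a partition of $V$ into cliques; it is maximal if it does not contain two different cliques $C,C'$ with $C\cup C'$ a clique. Fix an enumeration $\overline{C}_1,\ldots,\overline{C}_m$ of all maximal cliques of $G$. For $v\in V$ let $\mathit{cliques}(v):=\{i\in[m]\mid v\in\overline{C}_i\}$ and $d(v):=|\mathit{cliques}(v)|$. Fix an enumeration $S=[v_1,\ldots,v_s]$ of all vertices $v$ with $d(v)>1$. A configuration is a list $[C_1,\ldots,C_m]$ where each $C_i$ is empty or a clique, $C_i\subseteq\overline{C}_i$, and $\bigcup_i C_i=V$; $\mathit{repr}([C_1,\ldots,C_m]):=\{C_i\mid C_i\neq\emptyset\}$. For a vertex $v$ and index $i$, write $[C_1,\ldots,C_m]\to_{(v,i)}[C'_1,\ldots,C'_m]$ if $v\in C_i$, $C'_i=C_i$ and $C'_j=C_j\setminus\{v\}$ for $j\neq i$. The search tree $\mathbb{T}^S(G)$ has root $[\overline{C}_1,\ldots,\overline{C}_m]$ at depth $0$; a node at depth $k<s$ carrying configuration $\mathit{cfg}$ has, for each $i\in\mathit{cliques}(v_{k+1})$, a child at depth $k+1$ carrying $\mathit{cfg}'$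 with $\mathit{cfg}\to_{(v_{k+1},i)}\mathit{cfg}'$. -}

module Defs where

open import Data.Nat using (ℕ; zero; suc; _<_)
open import Data.Fin using (Fin; fromℕ<)
open import Data.Fin.Subset using (Subset; _∈_; _∉_; _⊆_; _∪_; _-_; Nonempty; ∣_∣)
open import Data.Fin.Subset.Properties using (_∈?_)
open import Data.Vec using (Vec; lookup; tabulate)
open import Data.List using (List)
open import Data.List.Relation.Unary.Unique.Propositional using (Unique)
import Data.List.Membership.Propositional as LM
open import Data.Sum using (_⊎_)
open import Data.Product using (Σ; ∃; ∃-syntax; _×_)
open import Relation.Binary.PropositionalEquality using (_≡_; _≢_)
open import Relation.Nullary using (¬_; does)
open import Function.Bundles using (_⇔_)

record Graph (n : ℕ) : Set₁ where
  field
    Adj     : Fin n → Fin n → Set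
    symm    : ∀ {x y} → Adj x y → Adj y x
    irrefl  : ∀ {x} → ¬ Adj x x

module _ {n : ℕ} (G : Graph n) where
  open Graph G

  IsClique : Subset n → Set
  IsClique C = Nonempty C × (∀ x y → x ∈ C → y ∈ C → x ≢ y → Adj x y)

  IsMaximalClique : Subset n → Set
  IsMaximalClique C = IsClique C × (∀ D → IsClique D → C ⊆ D → D ≡ C)

  IsCliquePartition : (Subset n → Set) → Set
  IsCliquePartition P =
      (∀ X → P X → IsClique X)
    × (∀ X Y → P X → P Y → X ≢ Y → ∀ v → v ∈ X → v ∉ Y)
    × (∀ v → ∃[ X ] (P X × v ∈ X))

  IsMaximalCliquePartition : (Subset n → Set) → Set
  IsMaximalCliquePartition P =
    IsCliquePartition P × (∀ C C' → P C → P C' → C ≢ C' → ¬ IsClique (C ∪ C'))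

  IsMaxCliqueEnum : {m : ℕ} → Vec (Subset n) m → Set
  IsMaxCliqueEnum {m} Cbar =
      (∀ i → IsMaximalClique (lookup Cbar i))
    × (∀ C → IsMaximalClique C → ∃[ i ] lookup Cbar i ≡ C)
    × (∀ i j → lookup Cbar i ≡ lookup Cbar j → i ≡ j)

  module _ {m : ℕ} (Cbar : Vec (Subset n) m) where

    cliques : Fin n → Subset m
    cliques v = tabulate (λ i → does (v ∈? lookup Cbar i))

    d : Fin n → ℕ
    d v = ∣ cliques v ∣

    IsSEnum : {s : ℕ} → Vec (Fin n) s → Set
    IsSEnum {s} S =
        (∀ k l → lookup S k ≡ lookup S l → k ≡ l)
      × (∀ v → (∃[ k ] lookup S k ≡ v) ⇔ (1 < d v))

    Config : Set
    Config = Vec (Subset n) m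

    IsConfig : Config → Set
    IsConfig cfg =
        (∀ i → ¬ Nonempty (lookup cfg i) ⊎ IsClique (lookup cfg i))
      × (∀ i → lookup cfg i ⊆ lookup Cbar i)
      × (∀ v → ∃[ i ] v ∈ lookup cfg i)

    repr : Config → Subset n → Set
    repr cfg X = ∃[ i ] (lookup cfg i ≡ X × Nonempty X)

    Step : Fin n → Fin m → Config → Config → Set
    Step v i cfg cfg' =
        v ∈ lookup cfg i
      × lookup cfg' i ≡ lookup cfg i
      × (∀ j → j ≢ i → lookup cfg' j ≡ (lookup cfg j - v))

    -- nodes of the search tree T^S(G): InTree S k cfg means that a node at
    -- depth k carrying configuration cfg occurs in the tree
    data InTree {s : ℕ} (S : Vec (Fin n) s) : ℕ → Config → Set where
      root  : InTree S zero Cbar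
      child : ∀ {k cfg cfg'} (k<s : k < s) (i : Fin m) →
              InTree S k cfg →
              i ∈ cliques (lookup S (fromℕ< k<s)) →
              Step (lookup S (fromℕ< k<s)) i cfg cfg' →
              InTree S (suc k) cfg'

module Submission where

-- Choose for every vertex v a maximal clique cliqueOf v containing the block of P through v,
-- canonically, so that all vertices of a block make the same choice. By maximality of P two
-- blocks inside one maximal clique coincide, so the blocks of P are exactly the fibres of
-- cliqueOf. Walking down the search tree, always sending v_{k+1} to cliqueOf v_{k+1}, reaches
-- at depth s the configuration in which the vertices of S keep only their chosen clique and
-- every other vertex keeps all of its cliques; but the latter lie in a single maximal clique,
-- so this configuration consists of the fibres of cliqueOf, i.e. it represents P.

open import Defs
open import Data.Nat using (ℕ)
open import Data.Fin.Subset using (Subset)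
open import Data.Vec using (Vec)
open import Data.Fin using (Fin)
open import Data.Product using (Σ; ∃; ∃-syntax; _×_)
open import Function.Bundles using (_⇔_)

open import Data.Bool using (Bool; true; if_then_else_)
import Data.Bool.Properties as Bool
open import Data.Empty using (⊥-elim)
import Data.Empty.Irrelevant as Irrelevant
open import Data.Fin using (toℕ; fromℕ<)
open import Data.Fin.Properties using (any?; all?; sequence; toℕ-fromℕ<; toℕ-injective; toℕ<n)
  renaming (_≟_ to _≟ᶠ_)
open import Data.Fin.Subset
  using (_∈_; _∉_; _⊆_; _⊃_; _∪_; _─_; _-_; ⁅_⁆; ⊥; Nonempty; ∣_∣; inside; outside)
open import Data.Fin.Subset.Properties
  using (_∈?_; _⊆?_; nonempty?; ⊆-antisym; ∉⊥; x∈⁅x⁆; x∈⁅y⁆⇒x≡y; x≢y⇒x∉⁅y⁆; ∣⁅x⁆∣≡1;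
         p⊂q⇒∣p∣<∣q∣; p⊆p∪q; x∈p∪q⁺; x∈p∪q⁻; x∈p∧x≢y⇒x∈p-y; p─q⊆p)
open import Data.Fin.Subset.Induction using (⊃-wellFounded; Acc; acc)
open import Data.Nat using (zero; suc; _≤_; _<_)
open import Data.Nat.Properties using (≤-refl; ≤-reflexive; ≤-trans; <⇒≤; n≤1+n; <-irrefl; m<1+n⇒m<n∨m≡n)
open import Data.Product using (_,_; proj₁; proj₂)
open import Data.Sum using (_⊎_; inj₁; inj₂)
open import Data.Vec using (_∷_; lookup; tabulate; here; there)
open import Data.Vec.Properties using (≡-dec; lookup∘tabulate; tabulate∘lookup; tabulate-cong; []=⇒lookup; lookup⇒[]=)
open import Effect.Applicative using (RawApplicative)
open import Effect.Monad using (RawMonad)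
open import Level using (0ℓ)
open import Function using (_∘_; id)
open import Function.Bundles using (mk⇔; module Equivalence)
open import Function.Construct.Composition using (_⇔-∘_)
open import Function.Construct.Symmetry using (⇔-sym)
open import Relation.Binary.PropositionalEquality using (_≡_; _≢_; refl; sym; trans; cong; subst)
open import Relation.Nullary using (¬_; Dec; yes; no; does; ¬?)
open import Relation.Nullary.Decidable using (dec-true; decidable-stable; ¬¬-excluded-middle; _×-dec_; _→-dec_)
open import Relation.Nullary.Negation using (¬¬-Monad; ¬¬-map)
open import Relation.Nullary.Negation.Core using (DoubleNegation)

open Equivalence using (to; from)

_≟ˢ_ : ∀ {n} (p q : Subset n) → Dec (p ≡ q)
_≟ˢ_ = ≡-dec Bool._≟_

⇔⇒≡ : ∀ {n} {p q : Subset n} → (∀ x → x ∈ p ⇔ x ∈ q) → p ≡ q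
⇔⇒≡ p⇔q = ⊆-antisym (to (p⇔q _)) (from (p⇔q _))

∈-tabulate : ∀ {n} (f : Fin n → Bool) {x : Fin n} → x ∈ tabulate f ⇔ f x ≡ true
∈-tabulate f {x} = mk⇔
  (λ x∈ → trans (sym (lookup∘tabulate f x)) ([]=⇒lookup x∈))
  (λ fx → lookup⇒[]= x (tabulate f) (trans (lookup∘tabulate f x) fx))

does≡true⇔ : ∀ {A : Set} (a? : Dec A) → does a? ≡ true ⇔ A
does≡true⇔ (yes a) = mk⇔ (λ _ → a) (λ _ → refl)
does≡true⇔ (no ¬a) = mk⇔ (λ ()) (⊥-elim ∘ ¬a)

x∈p─q⇒x∉q : ∀ {n} {x : Fin n} (p q : Subset n) → x ∈ p ─ q → x ∉ q
x∈p─q⇒x∉q (inside ∷ p) (outside ∷ q) here ()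
x∈p─q⇒x∉q (_ ∷ p) (_ ∷ q) (there x∈) (there x∈q) = x∈p─q⇒x∉q p q x∈ x∈q

x∈p-y⇒x≢y : ∀ {n} {x y : Fin n} (p : Subset n) → x ∈ p - y → x ≢ y
x∈p-y⇒x≢y {y = y} p x∈ refl = x∈p─q⇒x∉q p ⁅ y ⁆ x∈ (x∈⁅x⁆ y)

x≢y⇒x∈p-y⇔x∈p : ∀ {n} {x y : Fin n} {p : Subset n} → x ≢ y → x ∈ p - y ⇔ x ∈ p
x≢y⇒x∈p-y⇔x∈p {y = y} {p} x≢y = mk⇔ (p─q⊆p p ⁅ y ⁆) (λ x∈p → x∈p∧x≢y⇒x∈p-y x∈p x≢y)

x≢y⇒x∈p∪⁅y⁆⇔x∈p : ∀ {n} {x y : Fin n} {p : Subset n} → x ≢ y → x ∈ p ∪ ⁅ y ⁆ ⇔ x ∈ p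
x≢y⇒x∈p∪⁅y⁆⇔x∈p {x = x} {y} {p} x≢y = mk⇔ elim (x∈p∪q⁺ ∘ inj₁)
  where
  elim : x ∈ p ∪ ⁅ y ⁆ → x ∈ p
  elim x∈ with x∈p∪q⁻ p ⁅ y ⁆ x∈
  ... | inj₁ x∈p = x∈p
  ... | inj₂ x∈⁅y⁆ = ⊥-elim (x≢y (x∈⁅y⁆⇒x≡y y x∈⁅y⁆))

x∈p∧y∈p∧x≢y⇒1<∣p∣ : ∀ {n} {x y : Fin n} {p : Subset n} → x ∈ p → y ∈ p → x ≢ y → 1 < ∣ p ∣
x∈p∧y∈p∧x≢y⇒1<∣p∣ {x = x} {y} {p} x∈p y∈p x≢y =
  subst (_< ∣ p ∣) (∣⁅x⁆∣≡1 x)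
    (p⊂q⇒∣p∣<∣q∣ ((λ z∈ → subst (_∈ p) (sym (x∈⁅y⁆⇒x≡y x z∈)) x∈p) ,
                  y , y∈p , x≢y⇒x∉⁅y⁆ (x≢y ∘ sym)))

BlocksAreFibres : ∀ {n m} → (Subset n → Set) → (Fin n → Fin m) → Set
BlocksAreFibres P f = ∀ {X v w} → P X → v ∈ X → (w ∈ X ⇔ f w ≡ f v)

FibresOf : ∀ {n m} → (Fin n → Fin m) → Vec (Subset n) m → Set
FibresOf f cfg = ∀ v i → v ∈ lookup cfg i ⇔ f v ≡ i

module _ {n : ℕ} (G : Graph n) where
  open Graph G

  ⊆-isClique : ∀ {X K} → IsClique G K → Nonempty X → X ⊆ K → IsClique G X
  ⊆-isClique (_ , adj) X≠∅ X⊆K = X≠∅ , λ x y x∈X y∈X → adj x y (X⊆K x∈X) (X⊆K y∈X)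

  Extends : Subset n → Fin n → Set
  Extends C w = w ∉ C × (∀ x → x ∈ C → Adj x w)

  ∪⁅⁆-isClique : ∀ {C w} → IsClique G C → Extends C w → IsClique G (C ∪ ⁅ w ⁆)
  ∪⁅⁆-isClique {C} {w} (_ , adj) (w∉C , adjw) =
    (w , x∈p∪q⁺ (inj₂ (x∈⁅x⁆ w))) ,
    λ x y x∈ y∈ → adjacent (x∈p∪q⁻ C ⁅ w ⁆ x∈) (x∈p∪q⁻ C ⁅ w ⁆ y∈)
    where
    adjacent : ∀ {x y} → x ∈ C ⊎ x ∈ ⁅ w ⁆ → y ∈ C ⊎ y ∈ ⁅ w ⁆ → x ≢ y → Adj x y
    adjacent (inj₁ x∈C) (inj₁ y∈C) x≢y = adj _ _ x∈C y∈C x≢y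
    adjacent (inj₁ x∈C) (inj₂ y∈⁅w⁆) _ rewrite x∈⁅y⁆⇒x≡y w y∈⁅w⁆ = adjw _ x∈C
    adjacent (inj₂ x∈⁅w⁆) (inj₁ y∈C) _ rewrite x∈⁅y⁆⇒x≡y w x∈⁅w⁆ = symm (adjw _ y∈C)
    adjacent (inj₂ x∈⁅w⁆) (inj₂ y∈⁅w⁆) x≢y =
      ⊥-elim (x≢y (trans (x∈⁅y⁆⇒x≡y w x∈⁅w⁆) (sym (x∈⁅y⁆⇒x≡y w y∈⁅w⁆))))

  unextendable⇒maximal : ∀ {C} → IsClique G C → (∀ w → ¬ Extends C w) → IsMaximalClique G C
  unextendable⇒maximal {C} C-clique unextendable = C-clique , maximal
    where
    maximal : ∀ D → IsClique G D → C ⊆ D → D ≡ C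
    maximal D (_ , adj) C⊆D = ⊆-antisym D⊆C C⊆D
      where
      D⊆C : D ⊆ C
      D⊆C {w} w∈D with w ∈? C
      ... | yes w∈C = w∈C
      ... | no w∉C = ⊥-elim (unextendable w (w∉C , λ x x∈C →
                       adj x w (C⊆D x∈C) w∈D (λ x≡w → w∉C (subst (_∈ C) x≡w x∈C))))

  module _ (adj? : ∀ x y → Dec (Adj x y)) where

    extendable? : ∀ C → Dec (∃ (Extends C))
    extendable? C = any? λ w → ¬? (w ∈? C) ×-dec all? λ x → x ∈? C →-dec adj? x w

    ⊆-maximalClique : ∀ {C} → IsClique G C → ∃[ D ] (IsMaximalClique G D × C ⊆ D)
    ⊆-maximalClique C-clique = grow C-clique (⊃-wellFounded _)
      where
      grow : ∀ {C} → IsClique G C → Acc _⊃_ C → ∃[ D ] (IsMaximalClique G D × C ⊆ D)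
      grow {C} C-clique (acc larger) with extendable? C
      ... | no ∄w = C , unextendable⇒maximal C-clique (λ w e → ∄w (w , e)) , id
      ... | yes (w , e@(w∉C , _)) =
        let C⊂C∪w = (λ {x} → p⊆p∪q ⁅ w ⁆) , w , x∈p∪q⁺ (inj₂ (x∈⁅x⁆ w)) , w∉C
            D , D-maximal , C∪w⊆D = grow (∪⁅⁆-isClique C-clique e) (larger C⊂C∪w)
        in D , D-maximal , C∪w⊆D ∘ p⊆p∪q ⁅ w ⁆

  ¬¬-adjacency-decidable : ¬ ¬ (∀ x y → Dec (Adj x y))
  ¬¬-adjacency-decidable =
    sequence ¬¬-applicative λ x → sequence ¬¬-applicative λ y → ¬¬-excluded-middle
    where
    ¬¬-applicative : RawApplicative {0ℓ} DoubleNegation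
    ¬¬-applicative = RawMonad.rawApplicative ¬¬-Monad

  module Enumerated {m : ℕ} (Cbar : Vec (Subset n) m) (enum : IsMaxCliqueEnum G Cbar) where

    -- Growing X to a maximal clique needs decidable adjacency, but the conclusion is
    -- decidable, so the double negation of that assumption suffices.
    isClique⇒⊆-enumerated : ∀ {X} → IsClique G X → ∃[ i ] X ⊆ lookup Cbar i
    isClique⇒⊆-enumerated {X} X-clique =
      decidable-stable (any? λ i → X ⊆? lookup Cbar i) (¬¬-map enumerated ¬¬-adjacency-decidable)
      where
      enumerated : (∀ x y → Dec (Adj x y)) → ∃[ i ] X ⊆ lookup Cbar i
      enumerated adj? =
        let D , D-maximal , X⊆D = ⊆-maximalClique adj? X-clique
            i , Cbarᵢ≡D = proj₁ (proj₂ enum) D D-maximal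
        in i , subst (X ⊆_) (sym Cbarᵢ≡D) X⊆D

    -- The clique proof is irrelevant, so the chosen index depends on X alone.
    host : (X : Subset n) → .(IsClique G X) → Fin m
    host X X-clique with any? (λ i → X ⊆? lookup Cbar i)
    ... | yes (i , _) = i
    ... | no ∄i = Irrelevant.⊥-elim (∄i (isClique⇒⊆-enumerated X-clique))

    ⊆-host : ∀ {X} .(X-clique : IsClique G X) → X ⊆ lookup Cbar (host X X-clique)
    ⊆-host {X} X-clique with any? (λ i → X ⊆? lookup Cbar i)
    ... | yes (_ , X⊆Cbarᵢ) = X⊆Cbarᵢ
    ... | no ∄i = Irrelevant.⊥-elim (∄i (isClique⇒⊆-enumerated X-clique))

    host-cong : ∀ {X Y} .{X-clique : IsClique G X} .{Y-clique : IsClique G Y} →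
                X ≡ Y → host X X-clique ≡ host Y Y-clique
    host-cong refl = refl

  module _ {P : Subset n → Set} (partition : IsMaximalCliquePartition G P) where
    private
      block-clique : ∀ X → P X → IsClique G X
      block-clique = proj₁ (proj₁ partition)

      blocks-disjoint : ∀ X Y → P X → P Y → X ≢ Y → ∀ v → v ∈ X → v ∉ Y
      blocks-disjoint = proj₁ (proj₂ (proj₁ partition))

      unmergeable : ∀ X Y → P X → P Y → X ≢ Y → ¬ IsClique G (X ∪ Y)
      unmergeable = proj₂ partition

    blocks-meet⇒≡ : ∀ {X Y v} → P X → P Y → v ∈ X → v ∈ Y → X ≡ Y
    blocks-meet⇒≡ {X} {Y} PX PY v∈X v∈Y =
      decidable-stable (X ≟ˢ Y) λ X≢Y → blocks-disjoint X Y PX PY X≢Y _ v∈X v∈Y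

    blocks-⊆-clique⇒≡ : ∀ {X Y K} → P X → P Y → IsClique G K → X ⊆ K → Y ⊆ K → X ≡ Y
    blocks-⊆-clique⇒≡ {X} {Y} {K} PX PY K-clique X⊆K Y⊆K =
      decidable-stable (X ≟ˢ Y) λ X≢Y → unmergeable X Y PX PY X≢Y
        (⊆-isClique K-clique X∪Y≠∅ X∪Y⊆K)
      where
      X∪Y≠∅ : Nonempty (X ∪ Y)
      X∪Y≠∅ = let v , v∈X = proj₁ (block-clique X PX) in v , x∈p∪q⁺ (inj₁ v∈X)

      X∪Y⊆K : X ∪ Y ⊆ K
      X∪Y⊆K x∈ with x∈p∪q⁻ X Y x∈
      ... | inj₁ x∈X = X⊆K x∈X
      ... | inj₂ x∈Y = Y⊆K x∈Y

    module _ {m : ℕ} (Cbar : Vec (Subset n) m) (enum : IsMaxCliqueEnum G Cbar) where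
      open Enumerated Cbar enum

      private
        cover : ∀ v → ∃[ X ] (P X × v ∈ X)
        cover = proj₂ (proj₂ (proj₁ partition))

        block : Fin n → Subset n
        block v = proj₁ (cover v)

        P-block : ∀ v → P (block v)
        P-block v = proj₁ (proj₂ (cover v))

        ∈-block : ∀ v → v ∈ block v
        ∈-block v = proj₂ (proj₂ (cover v))

      cliqueOf : Fin n → Fin m
      cliqueOf v = host (block v) (block-clique _ (P-block v))

      block-⊆-cliqueOf : ∀ v → block v ⊆ lookup Cbar (cliqueOf v)
      block-⊆-cliqueOf v = ⊆-host (block-clique _ (P-block v))

      ∈-cliqueOf : ∀ v → v ∈ lookup Cbar (cliqueOf v)
      ∈-cliqueOf v = block-⊆-cliqueOf v (∈-block v)

      blocks-are-fibres : BlocksAreFibres P cliqueOf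
      blocks-are-fibres {X} {v} {w} PX v∈X = mk⇔ same-block⇒same-clique same-clique⇒same-block
        where
        block-v≡X : block v ≡ X
        block-v≡X = blocks-meet⇒≡ (P-block v) PX (∈-block v) v∈X

        same-block⇒same-clique : w ∈ X → cliqueOf w ≡ cliqueOf v
        same-block⇒same-clique w∈X =
          host-cong (trans (blocks-meet⇒≡ (P-block w) PX (∈-block w) w∈X) (sym block-v≡X))

        same-clique⇒same-block : cliqueOf w ≡ cliqueOf v → w ∈ X
        same-clique⇒same-block same =
          subst (w ∈_) (trans block-w≡block-v block-v≡X) (∈-block w)
          where
          block-w≡block-v : block w ≡ block v
          block-w≡block-v = blocks-⊆-clique⇒≡ (P-block w) (P-block v)
            (proj₁ (proj₁ enum (cliqueOf v)))
            (subst (λ i → block w ⊆ lookup Cbar i) same (block-⊆-cliqueOf w))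
            (block-⊆-cliqueOf v)

module Prefixes {n s : ℕ} (S : Vec (Fin n) s) where

  prefix : (k : ℕ) → k ≤ s → Subset n
  prefix zero _ = ⊥
  prefix (suc k) k<s = prefix k (<⇒≤ k<s) ∪ ⁅ lookup S (fromℕ< k<s) ⁆

  ∈-prefix : ∀ {j k} (k≤s : k ≤ s) → toℕ j < k → lookup S j ∈ prefix k k≤s
  ∈-prefix {j} {suc k} k<s j<1+k with m<1+n⇒m<n∨m≡n j<1+k
  ... | inj₁ j<k = x∈p∪q⁺ (inj₁ (∈-prefix (<⇒≤ k<s) j<k))
  ... | inj₂ j≡k rewrite toℕ-injective (trans j≡k (sym (toℕ-fromℕ< k<s))) = x∈p∪q⁺ (inj₂ (x∈⁅x⁆ _))

  ∉-prefix : (∀ k l → lookup S k ≡ lookup S l → k ≡ l) →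
             ∀ {j k} (k≤s : k ≤ s) → k ≤ toℕ j → lookup S j ∉ prefix k k≤s
  ∉-prefix S-injective {k = zero} _ _ = ∉⊥
  ∉-prefix S-injective {j} {suc k} k<s k<j Sⱼ∈ with x∈p∪q⁻ _ _ Sⱼ∈
  ... | inj₁ Sⱼ∈prefix = ∉-prefix S-injective (<⇒≤ k<s) (≤-trans (n≤1+n k) k<j) Sⱼ∈prefix
  ... | inj₂ Sⱼ∈⁅Sₖ⁆ = <-irrefl (sym toℕj≡k) k<j
    where
    toℕj≡k : toℕ j ≡ k
    toℕj≡k = trans (cong toℕ (S-injective _ _ (x∈⁅y⁆⇒x≡y _ Sⱼ∈⁅Sₖ⁆))) (toℕ-fromℕ< k<s)

∈-cliques : ∀ {n m} (G : Graph n) (Cbar : Vec (Subset n) m) {v i} →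
            v ∈ lookup Cbar i → i ∈ cliques G Cbar v
∈-cliques G Cbar {v} {i} v∈Cbarᵢ =
  from (∈-tabulate (λ j → does (v ∈? lookup Cbar j))) (dec-true (v ∈? lookup Cbar i) v∈Cbarᵢ)

∉-S⇒unique-clique : ∀ {n m s} (G : Graph n) (Cbar : Vec (Subset n) m) (S : Vec (Fin n) s) →
                    IsSEnum G Cbar S → ∀ {v i j} → v ∉ Prefixes.prefix S s ≤-refl →
                    v ∈ lookup Cbar i → v ∈ lookup Cbar j → i ≡ j
∉-S⇒unique-clique {s = s} G Cbar S (_ , S-complete) {v} {i} {j} v∉S v∈Cbarᵢ v∈Cbarⱼ =
  decidable-stable (i ≟ᶠ j) λ i≢j →
    let 1<dv = x∈p∧y∈p∧x≢y⇒1<∣p∣ (∈-cliques G Cbar v∈Cbarᵢ) (∈-cliques G Cbar v∈Cbarⱼ) i≢j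
        k , Sₖ≡v = from (S-complete v) 1<dv
    in v∉S (subst (_∈ prefix s ≤-refl) Sₖ≡v (∈-prefix ≤-refl (toℕ<n k)))
  where open Prefixes S

module Configurations {n m : ℕ} (G : Graph n) (Cbar : Vec (Subset n) m)
                      (f : Fin n → Fin m) (f-∈ : ∀ v → v ∈ lookup Cbar (f v)) where

  fibres-isConfig : ∀ {cfg} → (∀ i → IsClique G (lookup Cbar i)) → FibresOf f cfg →
                    IsConfig G Cbar cfg
  fibres-isConfig {cfg} Cbar-clique fibres = empty-or-clique , ⊆-Cbar , λ v → f v , from (fibres v _) refl
    where
    ⊆-Cbar : ∀ i → lookup cfg i ⊆ lookup Cbar i
    ⊆-Cbar i v∈ = subst (λ j → _ ∈ lookup Cbar j) (to (fibres _ i) v∈) (f-∈ _)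

    empty-or-clique : ∀ i → ¬ Nonempty (lookup cfg i) ⊎ IsClique G (lookup cfg i)
    empty-or-clique i with nonempty? (lookup cfg i)
    ... | no empty = inj₁ empty
    ... | yes nonempty = inj₂ (⊆-isClique G (Cbar-clique i) nonempty (⊆-Cbar i))

  fibres-repr : ∀ {cfg} {P : Subset n → Set} → FibresOf f cfg → IsCliquePartition G P →
                BlocksAreFibres P f → ∀ X → repr G Cbar cfg X ⇔ P X
  fibres-repr {cfg} {P} fibres (block-clique , _ , cover) blocks-are-fibres X =
    mk⇔ represented⇒block block⇒represented
    where
    fibre-of-block : ∀ {Y v} → P Y → v ∈ Y → lookup cfg (f v) ≡ Y
    fibre-of-block PY v∈Y = ⇔⇒≡ λ w → ⇔-sym (blocks-are-fibres PY v∈Y) ⇔-∘ fibres w _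

    represented⇒block : repr G Cbar cfg X → P X
    represented⇒block (i , cfgᵢ≡X , v , v∈X) =
      let Y , PY , v∈Y = cover v
          v∈cfgᵢ = subst (v ∈_) (sym cfgᵢ≡X) v∈X
          cfgᵢ≡Y = subst (λ j → lookup cfg j ≡ Y) (to (fibres v i) v∈cfgᵢ) (fibre-of-block PY v∈Y)
      in subst P (trans (sym cfgᵢ≡Y) cfgᵢ≡X) PY

    block⇒represented : P X → repr G Cbar cfg X
    block⇒represented PX =
      let v , v∈X = proj₁ (block-clique X PX)
      in f v , fibre-of-block PX v∈X , v , v∈X

  AssignedTo : Subset n → Fin n → Fin m → Set
  AssignedTo D v i = (v ∈ D × f v ≡ i) ⊎ (v ∉ D × v ∈ lookup Cbar i)

  cell : Subset n → Fin m → Subset n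
  cell D i = tabulate λ v →
    if does (v ∈? D) then does (f v ≟ᶠ i) else does (v ∈? lookup Cbar i)

  assign : Subset n → Config G Cbar
  assign D = tabulate (cell D)

  ∈-cell : ∀ {D v i} → v ∈ cell D i ⇔ AssignedTo D v i
  ∈-cell {D} {v} {i} = by-cases (v ∈? D) ⇔-∘ ∈-tabulate _
    where
    by-cases : (v∈D? : Dec (v ∈ D)) →
      (if does v∈D? then does (f v ≟ᶠ i) else does (v ∈? lookup Cbar i)) ≡ true ⇔ AssignedTo D v i
    by-cases (yes v∈D) = mk⇔ (λ fv≡i → inj₁ (v∈D , fv≡i)) assigned ⇔-∘ does≡true⇔ (f v ≟ᶠ i)
      where
      assigned : AssignedTo D v i → f v ≡ i
      assigned (inj₁ (_ , fv≡i)) = fv≡i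
      assigned (inj₂ (v∉D , _)) = ⊥-elim (v∉D v∈D)
    by-cases (no v∉D) = mk⇔ (λ v∈Cbarᵢ → inj₂ (v∉D , v∈Cbarᵢ)) assigned ⇔-∘ does≡true⇔ (v ∈? lookup Cbar i)
      where
      assigned : AssignedTo D v i → v ∈ lookup Cbar i
      assigned (inj₁ (v∈D , _)) = ⊥-elim (v∉D v∈D)
      assigned (inj₂ (_ , v∈Cbarᵢ)) = v∈Cbarᵢ

  ∈-assign : ∀ {D v i} → v ∈ lookup (assign D) i ⇔ AssignedTo D v i
  ∈-assign {D} {v} {i} rewrite lookup∘tabulate (cell D) i = ∈-cell

  assign-⊥ : assign ⊥ ≡ Cbar
  assign-⊥ = trans (tabulate-cong cell-⊥) (tabulate∘lookup Cbar)
    where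
    cell-⊥ : ∀ i → cell ⊥ i ≡ lookup Cbar i
    cell-⊥ i = ⇔⇒≡ λ v → mk⇔ assigned (λ v∈Cbarᵢ → inj₂ (∉⊥ , v∈Cbarᵢ)) ⇔-∘ ∈-cell
      where
      assigned : ∀ {v} → AssignedTo ⊥ v i → v ∈ lookup Cbar i
      assigned (inj₁ (v∈⊥ , _)) = ⊥-elim (∉⊥ v∈⊥)
      assigned (inj₂ (_ , v∈Cbarᵢ)) = v∈Cbarᵢ

  assignedTo-∪⁅⁆-new : ∀ {D u i} → AssignedTo (D ∪ ⁅ u ⁆) u i ⇔ f u ≡ i
  assignedTo-∪⁅⁆-new {D} {u} = mk⇔ assigned (λ fu≡i → inj₁ (u∈D∪u , fu≡i))
    where
    u∈D∪u : u ∈ D ∪ ⁅ u ⁆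
    u∈D∪u = x∈p∪q⁺ (inj₂ (x∈⁅x⁆ u))
    assigned : ∀ {i} → AssignedTo (D ∪ ⁅ u ⁆) u i → f u ≡ i
    assigned (inj₁ (_ , fu≡i)) = fu≡i
    assigned (inj₂ (u∉D∪u , _)) = ⊥-elim (u∉D∪u u∈D∪u)

  assignedTo-cong : ∀ {D D' v i} → (v ∈ D ⇔ v ∈ D') → AssignedTo D v i ⇔ AssignedTo D' v i
  assignedTo-cong D⇔D' = mk⇔ (transport D⇔D') (transport (⇔-sym D⇔D'))
    where
    transport : ∀ {D D' v i} → (v ∈ D ⇔ v ∈ D') → AssignedTo D v i → AssignedTo D' v i
    transport D⇔D' (inj₁ (v∈D , fv≡i)) = inj₁ (to D⇔D' v∈D , fv≡i)
    transport D⇔D' (inj₂ (v∉D , v∈Cbarᵢ)) = inj₂ (v∉D ∘ from D⇔D' , v∈Cbarᵢ)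

  assign-step : ∀ {D u} → u ∉ D → Step G Cbar u (f u) (assign D) (assign (D ∪ ⁅ u ⁆))
  assign-step {D} {u} u∉D = u∈chosen , chosen-unchanged , others-lose-u
    where
    old-vertex : ∀ {v i} → v ≢ u → v ∈ lookup (assign (D ∪ ⁅ u ⁆)) i ⇔ v ∈ lookup (assign D) i
    old-vertex v≢u = ⇔-sym ∈-assign ⇔-∘ (assignedTo-cong (x≢y⇒x∈p∪⁅y⁆⇔x∈p v≢u) ⇔-∘ ∈-assign)

    new-vertex : ∀ {i} → u ∈ lookup (assign (D ∪ ⁅ u ⁆)) i ⇔ f u ≡ i
    new-vertex = assignedTo-∪⁅⁆-new ⇔-∘ ∈-assign

    u∈chosen : u ∈ lookup (assign D) (f u)
    u∈chosen = from ∈-assign (inj₂ (u∉D , f-∈ u))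

    chosen-unchanged : lookup (assign (D ∪ ⁅ u ⁆)) (f u) ≡ lookup (assign D) (f u)
    chosen-unchanged = ⇔⇒≡ λ v → case v
      where
      case : ∀ v → v ∈ lookup (assign (D ∪ ⁅ u ⁆)) (f u) ⇔ v ∈ lookup (assign D) (f u)
      case v with v ≟ᶠ u
      ... | yes refl = mk⇔ (λ _ → u∈chosen) (λ _ → from new-vertex refl)
      ... | no v≢u = old-vertex v≢u

    others-lose-u : ∀ j → j ≢ f u → lookup (assign (D ∪ ⁅ u ⁆)) j ≡ lookup (assign D) j - u
    others-lose-u j j≢fu = ⇔⇒≡ λ v → case v
      where
      case : ∀ v → v ∈ lookup (assign (D ∪ ⁅ u ⁆)) j ⇔ v ∈ lookup (assign D) j - u
      case v with v ≟ᶠ u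
      ... | yes refl = mk⇔ (λ u∈ → ⊥-elim (j≢fu (sym (to new-vertex u∈))))
                           (λ u∈ → ⊥-elim (x∈p-y⇒x≢y _ u∈ refl))
      ... | no v≢u = ⇔-sym (x≢y⇒x∈p-y⇔x∈p v≢u) ⇔-∘ old-vertex v≢u

  assign-fibres : ∀ {D} → (∀ {v i} → v ∉ D → v ∈ lookup Cbar i → f v ≡ i) → FibresOf f (assign D)
  assign-fibres {D} unique-outside v i = mk⇔ assigned unassigned ⇔-∘ ∈-assign
    where
    assigned : AssignedTo D v i → f v ≡ i
    assigned (inj₁ (_ , fv≡i)) = fv≡i
    assigned (inj₂ (v∉D , v∈Cbarᵢ)) = unique-outside v∉D v∈Cbarᵢ

    unassigned : f v ≡ i → AssignedTo D v i
    unassigned refl with v ∈? D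
    ... | yes v∈D = inj₁ (v∈D , refl)
    ... | no v∉D = inj₂ (v∉D , f-∈ v)

  assign-prefix∈tree : ∀ {s} (S : Vec (Fin n) s) → (∀ k l → lookup S k ≡ lookup S l → k ≡ l) →
                       ∀ k (k≤s : k ≤ s) → InTree G Cbar S k (assign (Prefixes.prefix S k k≤s))
  assign-prefix∈tree S S-injective zero _ = subst (InTree G Cbar S zero) (sym assign-⊥) root
  assign-prefix∈tree S S-injective (suc k) k<s =
    child k<s (f u) (assign-prefix∈tree S S-injective k (<⇒≤ k<s)) (∈-cliques G Cbar (f-∈ u))
      (assign-step (Prefixes.∉-prefix S S-injective (<⇒≤ k<s) (≤-reflexive (sym (toℕ-fromℕ< k<s)))))
    where
    u : Fin n
    u = lookup S (fromℕ< k<s)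

corollary1 : ∀ {n m s} (G : Graph n) (Cbar : Vec (Subset n) m) (S : Vec (Fin n) s) → IsMaxCliqueEnum G Cbar → IsSEnum G Cbar S → (P : Subset n → Set) → IsMaximalCliquePartition G P → ∃[ k ] ∃[ cfg ] (InTree G Cbar S k cfg × IsConfig G Cbar cfg × (∀ X → repr G Cbar cfg X ⇔ P X))
corollary1 {s = s} G Cbar S enum S-enum P partition =
  s , assign final , assign-prefix∈tree S (proj₁ S-enum) s ≤-refl ,
  fibres-isConfig {assign final} (λ i → proj₁ (proj₁ enum i)) fibres ,
  fibres-repr {assign final} fibres (proj₁ partition) (blocks-are-fibres G partition Cbar enum)
  where
  κ : Fin _ → Fin _
  κ = cliqueOf G partition Cbar enum

  ∈-κ : ∀ v → v ∈ lookup Cbar (κ v)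
  ∈-κ = ∈-cliqueOf G partition Cbar enum

  open Configurations G Cbar κ ∈-κ

  final : Subset _
  final = Prefixes.prefix S s ≤-refl

  fibres : FibresOf κ (assign final)
  fibres = assign-fibres λ v∉S v∈Cbarᵢ → ∉-S⇒unique-clique G Cbar S S-enum v∉S (∈-κ _) v∈Cbarᵢ
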